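{- For all nonnegative integers $p$ and $q$, $$\alpha_{p,q}=\sum_{L\in\mathcal{D}(p,q)}\omega(L).$$
   Context: A signed $(p,q)$-involution ($p,q\ge0$, $n=p+q$) is an involution $\pi$ of $\{1,\dots,n\}$ together with a sign $+$ or $-$ on each fixed point such that (number of $+$) $-$ (number of $-$) $=p-q$; $\alpha_{p,q}$ is the number of them. $\mathcal{D}(p,q)$ is the set of Delannoy paths from $(0,0)$ to $(p,q)$ in $\mathbb{N}^2$, i.e. sequences of steps each of which is $E=(1,0)$, $N=(0,1)$ or $D=(1,1)$. A step from $(a,b)$ to $(a+1,b)$ or to $(a,b+1)$ has weight $1$; a diagonal step from $(a,b)$ to $(a+1,b+1)$ has weight $a+b+1$. The weight $\omega(L)$ of a path $L$ is the product of the weights of its steps. -}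

module Defs where

open import Data.Nat using (ℕ; zero; suc; _+_; _*_; _≡ᵇ_)
open import Data.Bool using (Bool; true; false; _∧_; not; T; if_then_else_)
open import Data.Fin using (Fin)
open import Data.Fin.Properties using (_≟_)
open import Data.Vec using (Vec; lookup)
open import Data.List using (List; []; _∷_; map; concatMap; filter; upTo; allFin)
open import Data.Nat.ListAction using (sum)
open import Data.Bool.ListAction using () renaming (all to allL)
open import Data.Product using (Σ; _×_; _,_)
open import Relation.Nullary.Decidable using (⌊_⌋)
open import Data.Bool.Properties using (T?)

data Sign : Set where
  plus minus : Sign

isPlus : Sign → Bool
isPlus plus  = true
isPlus minus = false

countFin : (n : ℕ) → (Fin n → Bool) → ℕ
countFin n P = sum (map (λ i → if P i then 1 else 0) (allFin n))

-- Signs are only meaningful on fixed points; to get a canonical encoding the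
-- sign of every non-fixed point is required to be `plus`.
module _ {n : ℕ} (π : Vec (Fin n) n) where
  isFixed : Fin n → Bool
  isFixed i = ⌊ lookup π i ≟ i ⌋

  isInvolution : Bool
  isInvolution = allL (λ i → ⌊ lookup π (lookup π i) ≟ i ⌋) (allFin n)

module _ {n : ℕ} (π : Vec (Fin n) n) (s : Vec Sign n) where

  signsCanonical : Bool
  signsCanonical = allL (λ i → if isFixed π i then true else isPlus (lookup s i)) (allFin n)

  numPlusFixed numMinusFixed : ℕ
  numPlusFixed  = countFin n (λ i → isFixed π i ∧ isPlus (lookup s i))
  numMinusFixed = countFin n (λ i → isFixed π i ∧ not (isPlus (lookup s i)))

-- (#plus) - (#minus) = p - q, written in ℕ as #plus + q = #minus + p
isSignedInvolution : (p q : ℕ) → Vec (Fin (p + q)) (p + q) → Vec Sign (p + q) → Bool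
isSignedInvolution p q π s =
  isInvolution π ∧ signsCanonical π s ∧
  ((numPlusFixed π s + q) ≡ᵇ (numMinusFixed π s + p))

SignedInvolution : ℕ → ℕ → Set
SignedInvolution p q =
  Σ (Vec (Fin (p + q)) (p + q) × Vec Sign (p + q))
    (λ { (π , s) → T (isSignedInvolution p q π s) })

data Step : Set where
  E N D : Step

words : ℕ → List (List Step)
words zero    = [] ∷ []
words (suc k) = concatMap (λ w → (E ∷ w) ∷ (N ∷ w) ∷ (D ∷ w) ∷ []) (words k)

endX endY : ℕ → List Step → ℕ
endX a []      = a
endX a (E ∷ w) = endX (suc a) w
endX a (N ∷ w) = endX a w
endX a (D ∷ w) = endX (suc a) w
endY b []      = b
endY b (E ∷ w) = endY b w
endY b (N ∷ w) = endY (suc b) w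
endY b (D ∷ w) = endY (suc b) w

endsAt : ℕ → ℕ → List Step → Bool
endsAt p q w = (endX 0 w ≡ᵇ p) ∧ (endY 0 w ≡ᵇ q)

weightFrom : ℕ → ℕ → List Step → ℕ
weightFrom a b []      = 1
weightFrom a b (E ∷ w) = weightFrom (suc a) b w
weightFrom a b (N ∷ w) = weightFrom a (suc b) w
weightFrom a b (D ∷ w) = (a + b + 1) * weightFrom (suc a) (suc b) w

ω : List Step → ℕ
ω = weightFrom 0 0

-- 𝒟(p,q): every Delannoy path to (p,q) has between 0 and p+q steps,
-- so it is enumerated exactly once here.
delannoyPaths : ℕ → ℕ → List (List Step)
delannoyPaths p q = filter (λ w → T? (endsAt p q w)) (concatMap words (upTo (suc (p + q))))

delannoyWeightSum : ℕ → ℕ → ℕ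
delannoyWeightSum p q = sum (map ω (delannoyPaths p q))

-- Both sides satisfy the recurrence `weightedDelannoy`:
--   A(0,0) = 1,  A(p+1,0) = A(p,0),  A(0,q+1) = A(0,q),
--   A(p+1,q+1) = A(p,q+1) + A(p+1,q) + (p+q+1)·A(p,q).
--
-- Splitting a path into its first k steps and its last step (an E, N
-- or D step, the last weighing p+q+1 when it ends at (p+1,q+1)) gives the
-- recurrence for the weight of paths of each length; summing over the
-- lengths yields `delannoyWeightSum p q ≡ weightedDelannoy p q`.
--
-- A signed involution of 1+n points either fixes 0 (with sign +
-- or −, shifting the balance p − q by one) or pairs 0 with one of the n other
-- points (leaving the balance unchanged); the rest is a signed involution of
-- n resp. n−1 points.

module Submission where

open import Defs
open import Data.Nat using (ℕ)
open import Data.Fin using (Fin)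
open import Function.Bundles using (_↔_)

open import Data.Nat using (zero; suc; pred; _+_; _*_; _≡ᵇ_; _≤_; _<_; z≤n; s≤s)
open import Data.Nat.Properties
  using (+-commutativeSemigroup; +-0-commutativeMonoid; +-comm; +-suc; +-identityʳ; *-identityʳ; *-comm;
         *-assoc; *-zeroʳ; *-distribˡ-+; ≡-irrelevant; ≡ᵇ⇒≡; ≡⇒≡ᵇ; ≤-refl; ≤-reflexive;
         ≤-trans; ≤-<-trans; <-≤-trans; <-irrefl; m≤n+m; n≤1+n; n<1+n; m<n⇒m<1+n; pred[n]≤n)
open import Algebra.Properties.CommutativeSemigroup +-commutativeSemigroup using (interchange)
open import Algebra.Properties.CommutativeMonoid.Sum +-0-commutativeMonoid
  using (sum-remove; sum-cong-≗) renaming (sum to ∑)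
open import Data.Bool using (Bool; true; false; T; not; _∧_; if_then_else_)
open import Data.Bool.Properties using (T?; T-≡; T-∧; T-irrelevant; ∧-zeroʳ)
open import Data.Bool.ListAction using (all)
open import Data.Fin using (zero; suc; punchIn; punchOut)
open import Data.Fin.Properties
  using (_≟_; suc-injective; punchIn-injective; punchInᵢ≢i; punchIn-punchOut; punchOut-punchIn;
         punchOut-cong; +↔⊎; *↔×)
open import Data.Vec using (Vec; []; lookup; tabulate)
open import Data.Vec.Properties using (lookup∘tabulate)
open import Data.Vec.Relation.Binary.Pointwise.Extensional using (ext; Pointwise-≡⇒≡)
open import Data.List using (List; []; _∷_; _∷ʳ_; _++_; map; concatMap; filter; upTo; allFin)
import Data.List as List
open import Data.List.Properties using (map-cong; map-++; map-applyUpTo; map-upTo; map-tabulate)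
open import Data.List.Membership.Propositional.Properties using (∈-allFin)
import Data.List.Relation.Unary.All as All
open import Data.List.Relation.Unary.All.Properties using (all⁺; all⁻)
open import Data.Nat.ListAction using (sum)
open import Data.Nat.ListAction.Properties using (sum-++)
open import Data.Product using (Σ; _×_; _,_; proj₁; proj₂)
open import Data.Product.Algebra using (Σ-assoc)
open import Data.Product.Properties using (Σ-≡,≡→≡)
open import Data.Product.Function.Dependent.Propositional using (Σ-↔; congˡ)
open import Data.Product.Function.NonDependent.Propositional using (_×-cong_)
open import Data.Sum using (_⊎_; inj₁; inj₂; [_,_]; [_,_]′)
open import Data.Sum.Algebra using (⊎-assoc; ⊎-comm)
open import Data.Sum.Function.Propositional using (_⊎-cong_)
open import Data.Empty using (⊥-elim)
open import Function using (_∘_; id; Equivalence; Injective)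
open import Function.Bundles using (mk↔ₛ′; Inverse)
open import Function.Properties.Inverse using (↔-refl; ↔-sym; ↔-trans)
open import Function.Related.Propositional using (module EquationalReasoning)
open import Function.Related.TypeIsomorphisms using (Σ-distribʳ-⊎)
open import Relation.Nullary using (¬_; yes; no)
open import Relation.Nullary.Decidable using (⌊_⌋; toWitness; fromWitness)
open import Relation.Binary.PropositionalEquality
  using (_≡_; _≢_; refl; sym; trans; cong; cong₂; subst; _≗_; module ≡-Reasoning)

sumMap : {A : Set} → (A → ℕ) → List A → ℕ
sumMap f xs = sum (map f xs)

module _ {A : Set} where

  sumMap-cong : {f g : A → ℕ} → f ≗ g → ∀ xs → sumMap f xs ≡ sumMap g xs
  sumMap-cong f≗g xs = cong sum (map-cong f≗g xs)

  sumMap-zero : (xs : List A) → sumMap (λ _ → 0) xs ≡ 0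
  sumMap-zero []       = refl
  sumMap-zero (_ ∷ xs) = sumMap-zero xs

  sumMap-+ : ∀ (f g : A → ℕ) xs → sumMap (λ x → f x + g x) xs ≡ sumMap f xs + sumMap g xs
  sumMap-+ f g []       = refl
  sumMap-+ f g (x ∷ xs) =
    trans (cong (f x + g x +_) (sumMap-+ f g xs)) (interchange (f x) (g x) (sumMap f xs) (sumMap g xs))

  sumMap-* : ∀ c (f : A → ℕ) xs → sumMap (λ x → c * f x) xs ≡ c * sumMap f xs
  sumMap-* c f []       = sym (*-zeroʳ c)
  sumMap-* c f (x ∷ xs) = trans (cong (c * f x +_) (sumMap-* c f xs)) (sym (*-distribˡ-+ c (f x) _))

  sumMap-comm : {B : Set} (F : A → B → ℕ) → ∀ xs ys →
    sumMap (λ x → sumMap (F x) ys) xs ≡ sumMap (λ y → sumMap (λ x → F x y) xs) ys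
  sumMap-comm F xs []       = sumMap-zero xs
  sumMap-comm F xs (y ∷ ys) = begin
    sumMap (λ x → F x y + sumMap (F x) ys) xs
      ≡⟨ sumMap-+ (λ x → F x y) _ xs ⟩
    sumMap (λ x → F x y) xs + sumMap (λ x → sumMap (F x) ys) xs
      ≡⟨ cong (sumMap (λ x → F x y) xs +_) (sumMap-comm F xs ys) ⟩
    sumMap (λ x → F x y) xs + sumMap (λ y → sumMap (λ x → F x y) xs) ys ∎
    where open ≡-Reasoning

  sumMap-concatMap : {B : Set} (g : B → ℕ) (h : A → List B) → ∀ xs →
    sumMap g (concatMap h xs) ≡ sumMap (λ x → sumMap g (h x)) xs
  sumMap-concatMap g h []       = refl
  sumMap-concatMap g h (x ∷ xs) = begin
    sum (map g (h x ++ concatMap h xs))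
      ≡⟨ cong sum (map-++ g (h x) _) ⟩
    sum (map g (h x) ++ map g (concatMap h xs))
      ≡⟨ sum-++ (map g (h x)) _ ⟩
    sumMap g (h x) + sumMap g (concatMap h xs)
      ≡⟨ cong (sumMap g (h x) +_) (sumMap-concatMap g h xs) ⟩
    sumMap g (h x) + sumMap (λ x → sumMap g (h x)) xs ∎
    where open ≡-Reasoning

  sumMap-filter : (b : A → Bool) (f : A → ℕ) → ∀ xs →
    sumMap f (filter (T? ∘ b) xs) ≡ sumMap (λ x → if b x then f x else 0) xs
  sumMap-filter b f []       = refl
  sumMap-filter b f (x ∷ xs) with b x
  ... | true  = cong (f x +_) (sumMap-filter b f xs)
  ... | false = sumMap-filter b f xs

sumMap-upTo-suc : (f : ℕ → ℕ) → ∀ m →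
  sumMap f (upTo (suc m)) ≡ f 0 + sumMap (f ∘ suc) (upTo m)
sumMap-upTo-suc f m =
  cong (λ fs → f 0 + sum fs) (trans (map-applyUpTo suc f m) (sym (map-upTo (f ∘ suc) m)))

allSteps : List Step
allSteps = E ∷ N ∷ D ∷ []

stepSum : (Step → ℕ) → ℕ
stepSum f = sumMap f allSteps

wordSum : ℕ → (List Step → ℕ) → ℕ
wordSum k g = sumMap g (words k)

-- `words (suc k)` prepends every step to every word of length k ...
wordSum-cons : ∀ k g → wordSum (suc k) g ≡ wordSum k (λ w → stepSum (λ x → g (x ∷ w)))
wordSum-cons k g = sumMap-concatMap g _ (words k)

-- ... so, exchanging the two step sums, it also appends every step to every word.
wordSum-snoc : ∀ k g → wordSum (suc k) g ≡ wordSum k (λ w → stepSum (λ x → g (w ∷ʳ x)))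
wordSum-snoc zero    g = wordSum-cons zero g
wordSum-snoc (suc k) g = begin
  wordSum (suc (suc k)) g                                          ≡⟨ wordSum-cons (suc k) g ⟩
  wordSum (suc k) (λ w → stepSum (λ x → g (x ∷ w)))                ≡⟨ wordSum-snoc k _ ⟩
  wordSum k (λ w → stepSum (λ y → stepSum (λ x → g (x ∷ w ∷ʳ y)))) ≡⟨ sumMap-cong swap (words k) ⟩
  wordSum k (λ w → stepSum (λ x → stepSum (λ y → g (x ∷ w ∷ʳ y)))) ≡⟨ wordSum-cons k _ ⟨
  wordSum (suc k) (λ w → stepSum (λ y → g (w ∷ʳ y)))               ∎
  where
  open ≡-Reasoning
  swap : ∀ w → stepSum (λ y → stepSum (λ x → g (x ∷ w ∷ʳ y)))
             ≡ stepSum (λ x → stepSum (λ y → g (x ∷ w ∷ʳ y)))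
  swap w = sumMap-comm (λ y x → g (x ∷ w ∷ʳ y)) allSteps allSteps

moveX moveY : Step → ℕ → ℕ
moveX E a = suc a
moveX N a = a
moveX D a = suc a
moveY E b = b
moveY N b = suc b
moveY D b = suc b

stepWeight : Step → ℕ → ℕ → ℕ
stepWeight E a b = 1
stepWeight N a b = 1
stepWeight D a b = a + b + 1

endX-snoc : ∀ a w x → endX a (w ∷ʳ x) ≡ moveX x (endX a w)
endX-snoc a []      E = refl
endX-snoc a []      N = refl
endX-snoc a []      D = refl
endX-snoc a (E ∷ w) x = endX-snoc (suc a) w x
endX-snoc a (N ∷ w) x = endX-snoc a w x
endX-snoc a (D ∷ w) x = endX-snoc (suc a) w x

endY-snoc : ∀ b w x → endY b (w ∷ʳ x) ≡ moveY x (endY b w)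
endY-snoc b []      E = refl
endY-snoc b []      N = refl
endY-snoc b []      D = refl
endY-snoc b (E ∷ w) x = endY-snoc b w x
endY-snoc b (N ∷ w) x = endY-snoc (suc b) w x
endY-snoc b (D ∷ w) x = endY-snoc (suc b) w x

weight-snoc : ∀ a b w x →
  weightFrom a b (w ∷ʳ x) ≡ weightFrom a b w * stepWeight x (endX a w) (endY b w)
weight-snoc a b []      E = refl
weight-snoc a b []      N = refl
weight-snoc a b []      D = *-comm (a + b + 1) 1
weight-snoc a b (E ∷ w) x = weight-snoc (suc a) b w x
weight-snoc a b (N ∷ w) x = weight-snoc a (suc b) w x
weight-snoc a b (D ∷ w) x =
  trans (cong ((a + b + 1) *_) (weight-snoc (suc a) (suc b) w x)) (sym (*-assoc (a + b + 1) _ _))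

weightAt : ℕ → ℕ → List Step → ℕ
weightAt p q w = if endsAt p q w then ω w else 0

-- The contribution to (p,q) of paths whose last step is x, given the
-- weights F of the points from which that step can be taken.
viaLast : Step → (ℕ → ℕ → ℕ) → ℕ → ℕ → ℕ
viaLast E F zero    q       = 0
viaLast E F (suc p) q       = F p q
viaLast N F p       zero    = 0
viaLast N F p       (suc q) = F p q
viaLast D F zero    q       = 0
viaLast D F (suc p) zero    = 0
viaLast D F (suc p) (suc q) = suc (p + q) * F p q

weightAt-diagonal : ∀ p q w →
  (if endsAt p q w then ω w * (endX 0 w + endY 0 w + 1) else 0) ≡ suc (p + q) * weightAt p q w
weightAt-diagonal p q w with endX 0 w ≡ᵇ p in atX | endY 0 w ≡ᵇ q in atY
... | false | _     = sym (*-zeroʳ (suc (p + q)))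
... | true  | false = sym (*-zeroʳ (suc (p + q)))
... | true  | true = begin
  ω w * (endX 0 w + endY 0 w + 1)
    ≡⟨ cong₂ (λ a b → ω w * (a + b + 1)) (reflects (endX 0 w) p atX) (reflects (endY 0 w) q atY) ⟩
  ω w * (p + q + 1)               ≡⟨ *-comm (ω w) (p + q + 1) ⟩
  (p + q + 1) * ω w               ≡⟨ cong (_* ω w) (+-comm (p + q) 1) ⟩
  suc (p + q) * ω w               ∎
  where
  open ≡-Reasoning
  reflects : ∀ m n → (m ≡ᵇ n) ≡ true → m ≡ n
  reflects m n eq = ≡ᵇ⇒≡ m n (Equivalence.from T-≡ eq)

weightAt-snoc : ∀ x p q w → weightAt p q (w ∷ʳ x) ≡ viaLast x (λ a b → weightAt a b w) p q
weightAt-snoc E zero    q       w rewrite endX-snoc 0 w E = refl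
weightAt-snoc E (suc p) q       w
  rewrite endX-snoc 0 w E | endY-snoc 0 w E | weight-snoc 0 0 w E | *-identityʳ (ω w) = refl
weightAt-snoc N p       zero    w
  rewrite endY-snoc 0 w N | ∧-zeroʳ (endX 0 (w ∷ʳ N) ≡ᵇ p) = refl
weightAt-snoc N p       (suc q) w
  rewrite endX-snoc 0 w N | endY-snoc 0 w N | weight-snoc 0 0 w N | *-identityʳ (ω w) = refl
weightAt-snoc D zero    q       w rewrite endX-snoc 0 w D = refl
weightAt-snoc D (suc p) zero    w
  rewrite endY-snoc 0 w D | ∧-zeroʳ (endX 0 (w ∷ʳ D) ≡ᵇ suc p) = refl
weightAt-snoc D (suc p) (suc q) w
  rewrite endX-snoc 0 w D | endY-snoc 0 w D | weight-snoc 0 0 w D = weightAt-diagonal p q w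

sumMap-viaLast : {A : Set} (x : Step) (G : A → ℕ → ℕ → ℕ) → ∀ xs p q →
  sumMap (λ a → viaLast x (G a) p q) xs ≡ viaLast x (λ b c → sumMap (λ a → G a b c) xs) p q
sumMap-viaLast E G xs zero    q       = sumMap-zero xs
sumMap-viaLast E G xs (suc p) q       = refl
sumMap-viaLast N G xs p       zero    = sumMap-zero xs
sumMap-viaLast N G xs p       (suc q) = refl
sumMap-viaLast D G xs zero    q       = sumMap-zero xs
sumMap-viaLast D G xs (suc p) zero    = sumMap-zero xs
sumMap-viaLast D G xs (suc p) (suc q) = sumMap-* (suc (p + q)) (λ a → G a p q) xs

lastStepSum : (ℕ → ℕ → ℕ) → ℕ → ℕ → ℕ
lastStepSum F p q = stepSum (λ x → viaLast x F p q)

sumMap-lastStepSum : {A : Set} (G : A → ℕ → ℕ → ℕ) → ∀ xs p q →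
  sumMap (λ a → lastStepSum (G a) p q) xs ≡ lastStepSum (λ b c → sumMap (λ a → G a b c) xs) p q
sumMap-lastStepSum G xs p q =
  trans (sumMap-comm (λ a x → viaLast x (G a) p q) xs allSteps)
        (sumMap-cong (λ x → sumMap-viaLast x G xs p q) allSteps)

pathWeight : ℕ → ℕ → ℕ → ℕ
pathWeight k p q = wordSum k (weightAt p q)

pathWeight-suc : ∀ k p q → pathWeight (suc k) p q ≡ lastStepSum (pathWeight k) p q
pathWeight-suc k p q = begin
  wordSum (suc k) (weightAt p q)                             ≡⟨ wordSum-snoc k (weightAt p q) ⟩
  wordSum k (λ w → stepSum (λ x → weightAt p q (w ∷ʳ x)))    ≡⟨ sumMap-cong lastStep (words k) ⟩
  wordSum k (λ w → lastStepSum (λ a b → weightAt a b w) p q) ≡⟨ sumMap-lastStepSum _ (words k) p q ⟩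
  lastStepSum (pathWeight k) p q                             ∎
  where
  open ≡-Reasoning
  lastStep : ∀ w →
    stepSum (λ x → weightAt p q (w ∷ʳ x)) ≡ lastStepSum (λ a b → weightAt a b w) p q
  lastStep w = sumMap-cong (λ x → weightAt-snoc x p q w) allSteps

weightBelow : ℕ → ℕ → ℕ → ℕ
weightBelow m p q = sumMap (λ k → pathWeight k p q) (upTo m)

weightBelow-suc : ∀ m p q →
  weightBelow (suc m) p q ≡ pathWeight 0 p q + lastStepSum (weightBelow m) p q
weightBelow-suc m p q = begin
  weightBelow (suc m) p q
    ≡⟨ sumMap-upTo-suc (λ k → pathWeight k p q) m ⟩
  pathWeight 0 p q + sumMap (λ k → pathWeight (suc k) p q) (upTo m)
    ≡⟨ cong (pathWeight 0 p q +_) lastSteps ⟩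
  pathWeight 0 p q + lastStepSum (weightBelow m) p q ∎
  where
  open ≡-Reasoning
  lastSteps : sumMap (λ k → pathWeight (suc k) p q) (upTo m) ≡ lastStepSum (weightBelow m) p q
  lastSteps = trans (sumMap-cong (λ k → pathWeight-suc k p q) (upTo m))
                    (sumMap-lastStepSum pathWeight (upTo m) p q)

weightedDelannoy : ℕ → ℕ → ℕ
weightedDelannoy zero    zero    = 1
weightedDelannoy (suc p) zero    = weightedDelannoy p zero
weightedDelannoy zero    (suc q) = weightedDelannoy zero q
weightedDelannoy (suc p) (suc q) =
  weightedDelannoy p (suc q) + (weightedDelannoy (suc p) q + suc (p + q) * weightedDelannoy p q)

-- Every cut-off m beyond p+q (the maximal length of a path to (p,q)) yields the
-- recurrence; induction on (p,q) through the last-step decomposition.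
weightBelow≡weightedDelannoy : ∀ m p q → p + q < m → weightBelow m p q ≡ weightedDelannoy p q
weightBelow≡weightedDelannoy (suc m) zero    zero    _ = weightBelow-suc m 0 0
weightBelow≡weightedDelannoy (suc m) (suc p) zero    (s≤s p<m) =
  trans (weightBelow-suc m (suc p) 0)
        (trans (+-identityʳ _) (weightBelow≡weightedDelannoy m p 0 p<m))
weightBelow≡weightedDelannoy (suc m) zero    (suc q) (s≤s q<m) =
  trans (weightBelow-suc m 0 (suc q))
        (trans (+-identityʳ _) (weightBelow≡weightedDelannoy m 0 q q<m))
weightBelow≡weightedDelannoy (suc m) (suc p) (suc q) (s≤s p+[1+q]<m) =
  trans (weightBelow-suc m (suc p) (suc q))
        (cong₂ _+_ (weightBelow≡weightedDelannoy m p (suc q) p+[1+q]<m)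
          (cong₂ _+_ (weightBelow≡weightedDelannoy m (suc p) q [1+p]+q<m)
            (trans (+-identityʳ _)
                   (cong (suc (p + q) *_) (weightBelow≡weightedDelannoy m p q p+q<m)))))
  where
  [1+p]+q<m : suc p + q < m
  [1+p]+q<m = subst (_< m) (+-suc p q) p+[1+q]<m
  p+q<m : p + q < m
  p+q<m = ≤-trans (n≤1+n (suc (p + q))) [1+p]+q<m

delannoyWeightSum≡weightedDelannoy : ∀ p q → delannoyWeightSum p q ≡ weightedDelannoy p q
delannoyWeightSum≡weightedDelannoy p q = begin
  delannoyWeightSum p q
    ≡⟨ sumMap-filter (endsAt p q) ω (concatMap words (upTo (suc (p + q)))) ⟩
  sumMap (weightAt p q) (concatMap words (upTo (suc (p + q))))
    ≡⟨ sumMap-concatMap (weightAt p q) words (upTo (suc (p + q))) ⟩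
  weightBelow (suc (p + q)) p q
    ≡⟨ weightBelow≡weightedDelannoy (suc (p + q)) p q ≤-refl ⟩
  weightedDelannoy p q ∎
  where open ≡-Reasoning

allFin-sound : ∀ {n} (P : Fin n → Bool) → T (all P (allFin n)) → ∀ i → T (P i)
allFin-sound P t i = All.lookup (all⁺ P _ t) (∈-allFin i)

allFin-complete : ∀ {n} (P : Fin n → Bool) → (∀ i → T (P i)) → T (all P (allFin n))
allFin-complete {n} P h = all⁻ P {xs = allFin n} (All.tabulate (λ {i} _ → h i))

IsInvolution : ∀ {n} → (Fin n → Fin n) → Set
IsInvolution f = ∀ i → f (f i) ≡ i

SignsCanonical : ∀ {n} → (Fin n → Fin n) → (Fin n → Sign) → Set
SignsCanonical f σ = ∀ i → f i ≢ i → σ i ≡ plus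

isInvolution-sound : ∀ {n} (π : Vec (Fin n) n) → T (isInvolution π) → IsInvolution (lookup π)
isInvolution-sound π t i = toWitness (allFin-sound _ t i)

isInvolution-complete : ∀ {n} (π : Vec (Fin n) n) → IsInvolution (lookup π) → T (isInvolution π)
isInvolution-complete π h = allFin-complete _ (λ i → fromWitness (h i))

isPlus-sound : ∀ σ → T (isPlus σ) → σ ≡ plus
isPlus-sound plus _ = refl

signsCanonical-sound : ∀ {n} (π : Vec (Fin n) n) s →
  T (signsCanonical π s) → SignsCanonical (lookup π) (lookup s)
signsCanonical-sound π s t i moved with lookup π i ≟ i | allFin-sound _ t i
... | yes fixed | _         = ⊥-elim (moved fixed)
... | no  _     | plus-sign = isPlus-sound (lookup s i) plus-sign

signsCanonical-complete : ∀ {n} (π : Vec (Fin n) n) s →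
  SignsCanonical (lookup π) (lookup s) → T (signsCanonical π s)
signsCanonical-complete π s h = allFin-complete _ canonicalAt
  where
  canonicalAt : ∀ i → T (if isFixed π i then true else isPlus (lookup s i))
  canonicalAt i with lookup π i ≟ i
  ... | yes _     = _
  ... | no  moved rewrite h i moved = _

-- Signed involutions of n points, without the balance condition

record SignedInv (n : ℕ) : Set where
  constructor signedInv
  field
    perm  : Vec (Fin n) n
    signs : Vec Sign n
    valid : T (isInvolution perm ∧ signsCanonical perm signs)

  image : Fin n → Fin n
  image = lookup perm

  sign : Fin n → Sign
  sign = lookup signs

  involutive : IsInvolution image
  involutive = isInvolution-sound perm (proj₁ (Equivalence.to T-∧ valid))

  canonical : SignsCanonical image sign
  canonical = signsCanonical-sound perm signs (proj₂ (Equivalence.to T-∧ valid))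

  image-injective : ∀ {a b} → image a ≡ image b → a ≡ b
  image-injective {a} {b} eq = trans (sym (involutive a)) (trans (cong image eq) (involutive b))

open SignedInv

mkSignedInv : ∀ {n} (f : Fin n → Fin n) (σ : Fin n → Sign) →
  IsInvolution f → SignsCanonical f σ → SignedInv n
mkSignedInv f σ invol canon = signedInv (tabulate f) (tabulate σ)
  (Equivalence.from T-∧ ( isInvolution-complete (tabulate f) invol′
                         , signsCanonical-complete (tabulate f) (tabulate σ) canon′))
  where
  invol′ : IsInvolution (lookup (tabulate f))
  invol′ i rewrite lookup∘tabulate f i | lookup∘tabulate f (f i) = invol i
  canon′ : SignsCanonical (lookup (tabulate f)) (lookup (tabulate σ))
  canon′ i rewrite lookup∘tabulate f i | lookup∘tabulate σ i = canon i

SignedInv-ext : ∀ {n} {x y : SignedInv n} → image x ≗ image y → sign x ≗ sign y → x ≡ y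
SignedInv-ext {x = signedInv π s v} {signedInv π′ s′ v′} same-image same-sign
  with Pointwise-≡⇒≡ {xs = π} {π′} (ext same-image)
     | Pointwise-≡⇒≡ {xs = s} {s′} (ext same-sign)
... | refl | refl = cong (signedInv π s) (T-irrelevant v v′)

-- Restriction to an invariant set of points, relabelled along an embedding e:
-- whenever f describes x on the image of e, f is a signed involution again.
module Restriction {m k} (x : SignedInv m) (e : Fin k → Fin m) (e-injective : Injective _≡_ _≡_ e)
         (f : Fin k → Fin k) (commutes : ∀ i → e (f i) ≡ image x (e i)) where

  restrict : SignedInv k
  restrict = mkSignedInv f (sign x ∘ e) invol canon
    where
    open ≡-Reasoning
    invol : IsInvolution f
    invol i = e-injective (begin
      e (f (f i))            ≡⟨ commutes (f i) ⟩
      image x (e (f i))      ≡⟨ cong (image x) (commutes i) ⟩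
      image x (image x (e i)) ≡⟨ involutive x (e i) ⟩
      e i                    ∎)
    canon : SignsCanonical f (sign x ∘ e)
    canon i moved = canonical x (e i) (λ fixed → moved (e-injective (trans (commutes i) fixed)))

  image-restrict : ∀ i → e (image restrict i) ≡ image x (e i)
  image-restrict i = trans (cong e (lookup∘tabulate f i)) (commutes i)

  sign-restrict : ∀ i → sign restrict i ≡ sign x (e i)
  sign-restrict = lookup∘tabulate (sign x ∘ e)

  restrict-unique : (y : SignedInv k) → (∀ i → e (image y i) ≡ image x (e i)) →
    (∀ i → sign y i ≡ sign x (e i)) → restrict ≡ y
  restrict-unique y image-y sign-y = SignedInv-ext
    (λ i → e-injective (trans (image-restrict i) (sym (image-y i))))
    (λ i → trans (sign-restrict i) (sym (sign-y i)))

fixMap : ∀ {n} → (Fin n → Fin n) → Fin (suc n) → Fin (suc n)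
fixMap f zero    = zero
fixMap f (suc i) = suc (f i)

fixSign : ∀ {n} → Sign → (Fin n → Sign) → Fin (suc n) → Sign
fixSign σ g zero    = σ
fixSign σ g (suc i) = g i

fix : ∀ {n} → Sign → SignedInv n → SignedInv (suc n)
fix σ y = mkSignedInv (fixMap (image y)) (fixSign σ (sign y)) invol canon
  where
  invol : IsInvolution (fixMap (image y))
  invol zero    = refl
  invol (suc i) = cong suc (involutive y i)
  canon : SignsCanonical (fixMap (image y)) (fixSign σ (sign y))
  canon zero    moved = ⊥-elim (moved refl)
  canon (suc i) moved = canonical y i (moved ∘ cong suc)

image-fix : ∀ {n} σ (y : SignedInv n) i → image (fix σ y) (suc i) ≡ suc (image y i)
image-fix σ y i = lookup∘tabulate (fixMap (image y)) (suc i)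

sign-fix : ∀ {n} σ (y : SignedInv n) i → sign (fix σ y) (suc i) ≡ sign y i
sign-fix σ y i = lookup∘tabulate (fixSign σ (sign y)) (suc i)

module Unfix {n} (x : SignedInv (suc n)) (fixed : image x zero ≡ zero) where

  avoids : ∀ i → zero ≢ image x (suc i)
  avoids i eq with image-injective x (trans fixed eq)
  ... | ()

  open Restriction x suc suc-injective (λ i → punchOut (avoids i)) (λ i → punchIn-punchOut (avoids i))
    public

unfix : ∀ {n} (x : SignedInv (suc n)) → image x zero ≡ zero → SignedInv n
unfix = Unfix.restrict

unfix-fix : ∀ {n} σ (y : SignedInv n) → unfix (fix σ y) refl ≡ y
unfix-fix σ y = Unfix.restrict-unique (fix σ y) refl y
  (λ i → sym (image-fix σ y i)) (λ i → sym (sign-fix σ y i))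

fix-unfix : ∀ {n} (x : SignedInv (suc n)) (fixed : image x zero ≡ zero) →
  fix (sign x zero) (unfix x fixed) ≡ x
fix-unfix x fixed = SignedInv-ext sameImage sameSign
  where
  y = unfix x fixed
  sameImage : ∀ a → image (fix (sign x zero) y) a ≡ image x a
  sameImage zero    = sym fixed
  sameImage (suc i) = trans (image-fix (sign x zero) y i) (Unfix.image-restrict x fixed i)
  sameSign : ∀ a → sign (fix (sign x zero) y) a ≡ sign x a
  sameSign zero    = refl
  sameSign (suc i) = trans (sign-fix (sign x zero) y i) (Unfix.sign-restrict x fixed i)

outside : ∀ {k} → Fin (suc k) → Fin k → Fin (suc (suc k))
outside j = suc ∘ punchIn j

outside-injective : ∀ {k} (j : Fin (suc k)) → Injective _≡_ _≡_ (outside j)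
outside-injective j = punchIn-injective j _ _ ∘ suc-injective

data PairView {k} (j : Fin (suc k)) : Fin (suc (suc k)) → Set where
  first   : PairView j zero
  partner : PairView j (suc j)
  other   : ∀ i → PairView j (suc (punchIn j i))

pairView : ∀ {k} (j : Fin (suc k)) a → PairView j a
pairView j zero = first
pairView j (suc z) with j ≟ z
... | yes refl = partner
... | no  j≢z  = subst (PairView j ∘ suc) (punchIn-punchOut j≢z) (other (punchOut j≢z))

pairCases : ∀ {A : Set} {k} (j : Fin (suc k)) → A → A → (Fin k → A) → Fin (suc (suc k)) → A
pairCases j a b g zero = a
pairCases j a b g (suc z) with j ≟ z
... | yes _   = b
... | no  j≢z = g (punchOut j≢z)

module _ {A : Set} {k} (j : Fin (suc k)) (a b : A) (g : Fin k → A) where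

  pairCases-partner : pairCases j a b g (suc j) ≡ b
  pairCases-partner with j ≟ j
  ... | yes _   = refl
  ... | no  j≢j = ⊥-elim (j≢j refl)

  pairCases-other : ∀ i → pairCases j a b g (suc (punchIn j i)) ≡ g i
  pairCases-other i with j ≟ punchIn j i
  ... | yes j≡ = ⊥-elim (punchInᵢ≢i j i (sym j≡))
  ... | no  j≢ = cong g (trans (punchOut-cong j refl) (punchOut-punchIn j))

pairMap : ∀ {k} → Fin (suc k) → (Fin k → Fin k) → Fin (suc (suc k)) → Fin (suc (suc k))
pairMap j f = pairCases j (suc j) zero (suc ∘ punchIn j ∘ f)

pairSign : ∀ {k} → Fin (suc k) → (Fin k → Sign) → Fin (suc (suc k)) → Sign
pairSign j σ = pairCases j plus plus σ

module _ {k} (j : Fin (suc k)) where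

  pairMap-partner : ∀ f → pairMap j f (suc j) ≡ zero
  pairMap-partner f = pairCases-partner j (suc j) zero (suc ∘ punchIn j ∘ f)

  pairMap-other : ∀ f i → pairMap j f (suc (punchIn j i)) ≡ suc (punchIn j (f i))
  pairMap-other f = pairCases-other j (suc j) zero (suc ∘ punchIn j ∘ f)

  pairSign-partner : ∀ σ → pairSign j σ (suc j) ≡ plus
  pairSign-partner σ = pairCases-partner j plus plus σ

  pairSign-other : ∀ σ i → pairSign j σ (suc (punchIn j i)) ≡ σ i
  pairSign-other σ = pairCases-other j plus plus σ

pair : ∀ {k} → Fin (suc k) → SignedInv k → SignedInv (suc (suc k))
pair j y = mkSignedInv (pairMap j (image y)) (pairSign j (sign y)) invol canon
  where
  open ≡-Reasoning
  F = pairMap j (image y)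
  invol : IsInvolution F
  invol a with pairView j a
  ... | first   = pairMap-partner j (image y)
  ... | partner = cong F (pairMap-partner j (image y))
  ... | other i = begin
    F (F (suc (punchIn j i)))             ≡⟨ cong F (pairMap-other j (image y) i) ⟩
    F (suc (punchIn j (image y i)))       ≡⟨ pairMap-other j (image y) (image y i) ⟩
    suc (punchIn j (image y (image y i))) ≡⟨ cong (suc ∘ punchIn j) (involutive y i) ⟩
    suc (punchIn j i)                     ∎
  canon : SignsCanonical F (pairSign j (sign y))
  canon a moved with pairView j a
  ... | first   = refl
  ... | partner = pairSign-partner j (sign y)
  ... | other i = trans (pairSign-other j (sign y) i)
    (canonical y i (λ fixed → moved (trans (pairMap-other j (image y) i) (cong (suc ∘ punchIn j) fixed))))

module _ {k} (j : Fin (suc k)) (y : SignedInv k) where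

  image-pair-partner : image (pair j y) (suc j) ≡ zero
  image-pair-partner = trans (lookup∘tabulate (pairMap j (image y)) (suc j)) (pairMap-partner j (image y))

  image-pair-other : ∀ i → image (pair j y) (suc (punchIn j i)) ≡ suc (punchIn j (image y i))
  image-pair-other i =
    trans (lookup∘tabulate (pairMap j (image y)) (suc (punchIn j i))) (pairMap-other j (image y) i)

  sign-pair-partner : sign (pair j y) (suc j) ≡ plus
  sign-pair-partner = trans (lookup∘tabulate (pairSign j (sign y)) (suc j)) (pairSign-partner j (sign y))

  sign-pair-other : ∀ i → sign (pair j y) (suc (punchIn j i)) ≡ sign y i
  sign-pair-other i =
    trans (lookup∘tabulate (pairSign j (sign y)) (suc (punchIn j i))) (pairSign-other j (sign y) i)

module Unpair {k} (j : Fin (suc k)) (x : SignedInv (suc (suc k))) (paired : image x zero ≡ suc j) where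

  partner↦first : image x (suc j) ≡ zero
  partner↦first = trans (cong (image x) (sym paired)) (involutive x zero)

  first-moved : image x zero ≢ zero
  first-moved fixed with trans (sym paired) fixed
  ... | ()

  partner-moved : image x (suc j) ≢ suc j
  partner-moved fixed with trans (sym partner↦first) fixed
  ... | ()

  avoids-first : ∀ i → zero ≢ image x (outside j i)
  avoids-first i eq =
    punchInᵢ≢i j i (sym (suc-injective (image-injective x (trans partner↦first eq))))

  avoids-partner : ∀ i → suc j ≢ image x (outside j i)
  avoids-partner i eq with image-injective x (trans paired eq)
  ... | ()

  avoids-partner′ : ∀ i → j ≢ punchOut (avoids-first i)
  avoids-partner′ i eq = avoids-partner i (trans (cong suc eq) (punchIn-punchOut (avoids-first i)))

  restricted : Fin k → Fin k
  restricted i = punchOut (avoids-partner′ i)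

  commutes : ∀ i → outside j (restricted i) ≡ image x (outside j i)
  commutes i = trans (cong suc (punchIn-punchOut (avoids-partner′ i))) (punchIn-punchOut (avoids-first i))

  open Restriction x (outside j) (outside-injective j) restricted commutes public

unpair : ∀ {k} (j : Fin (suc k)) (x : SignedInv (suc (suc k))) → image x zero ≡ suc j → SignedInv k
unpair = Unpair.restrict

unpair-pair : ∀ {k} j (y : SignedInv k) → unpair j (pair j y) refl ≡ y
unpair-pair j y = Unpair.restrict-unique j (pair j y) refl y
  (λ i → sym (image-pair-other j y i)) (λ i → sym (sign-pair-other j y i))

pair-unpair : ∀ {k} j (x : SignedInv (suc (suc k))) (paired : image x zero ≡ suc j) →
  pair j (unpair j x paired) ≡ x
pair-unpair j x paired = SignedInv-ext sameImage sameSign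
  where
  open Unpair j x paired using (partner↦first; first-moved; partner-moved; image-restrict; sign-restrict)
  y = unpair j x paired
  sameImage : ∀ a → image (pair j y) a ≡ image x a
  sameImage a with pairView j a
  ... | first   = sym paired
  ... | partner = trans (image-pair-partner j y) (sym partner↦first)
  ... | other i = trans (image-pair-other j y i) (image-restrict i)
  sameSign : ∀ a → sign (pair j y) a ≡ sign x a
  sameSign a with pairView j a
  ... | first   = sym (canonical x zero first-moved)
  ... | partner = trans (sign-pair-partner j y) (sym (canonical x (suc j) partner-moved))
  ... | other i = trans (sign-pair-other j y i) (sign-restrict i)

-- 0 is a fixed point with a sign, or it is paired with one of the n other points
Decomposition : ℕ → Set
Decomposition n = (Sign × SignedInv n) ⊎ (Fin n × SignedInv (pred n))

pairWith : ∀ {n} → Fin n → SignedInv (pred n) → SignedInv (suc n)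
pairWith {suc k} = pair

compose : ∀ {n} → Decomposition n → SignedInv (suc n)
compose (inj₁ (σ , y)) = fix σ y
compose (inj₂ (j , y)) = pairWith j y

decomposeAt : ∀ {n} (x : SignedInv (suc n)) a → image x zero ≡ a → Decomposition n
decomposeAt         x zero    fixed  = inj₁ (sign x zero , unfix x fixed)
decomposeAt {suc k} x (suc j) paired = inj₂ (j , unpair j x paired)

decompose : ∀ {n} → SignedInv (suc n) → Decomposition n
decompose x = decomposeAt x (image x zero) refl

decompose-compose : ∀ {n} (d : Decomposition n) → decompose (compose d) ≡ d
decompose-compose         (inj₁ (σ , y)) = cong (λ y → inj₁ (σ , y)) (unfix-fix σ y)
decompose-compose {suc k} (inj₂ (j , y)) = cong (λ y → inj₂ (j , y)) (unpair-pair j y)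

compose-decomposeAt : ∀ {n} (x : SignedInv (suc n)) a (eq : image x zero ≡ a) →
  compose (decomposeAt x a eq) ≡ x
compose-decomposeAt         x zero    fixed  = fix-unfix x fixed
compose-decomposeAt {suc k} x (suc j) paired = pair-unpair j x paired

decomposition : ∀ {n} → SignedInv (suc n) ↔ Decomposition n
decomposition =
  mk↔ₛ′ decompose compose decompose-compose (λ x → compose-decomposeAt x (image x zero) refl)

indicator : Bool → ℕ
indicator b = if b then 1 else 0

fixedTerm : ∀ {n} → (Sign → Bool) → SignedInv n → Fin n → ℕ
fixedTerm c x i = indicator (isFixed (perm x) i ∧ c (sign x i))

fixedCount : ∀ {n} → (Sign → Bool) → SignedInv n → ℕ
fixedCount c x = ∑ (fixedTerm c x)

sum-tabulate : ∀ {n} (f : Fin n → ℕ) → sum (List.tabulate f) ≡ ∑ f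
sum-tabulate {zero}  f = refl
sum-tabulate {suc n} f = cong (f zero +_) (sum-tabulate (f ∘ suc))

countFin-∑ : ∀ n (P : Fin n → Bool) → countFin n P ≡ ∑ (indicator ∘ P)
countFin-∑ n P =
  trans (cong sum (map-tabulate (λ i → i) (indicator ∘ P))) (sum-tabulate (indicator ∘ P))

∑-indicator≤ : ∀ n (b : Fin n → Bool) → ∑ (indicator ∘ b) ≤ n
∑-indicator≤ zero    b = z≤n
∑-indicator≤ (suc n) b with b zero
... | true  = s≤s (∑-indicator≤ n (b ∘ suc))
... | false = ≤-trans (∑-indicator≤ n (b ∘ suc)) (n≤1+n n)

fixedCount≤ : ∀ {n} c (x : SignedInv n) → fixedCount c x ≤ n
fixedCount≤ {n} c x = ∑-indicator≤ n (λ i → isFixed (perm x) i ∧ c (sign x i))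

≟-injective : ∀ {k m} (e : Fin k → Fin m) → Injective _≡_ _≡_ e →
  ∀ a b → ⌊ e a ≟ e b ⌋ ≡ ⌊ a ≟ b ⌋
≟-injective e e-injective a b with a ≟ b | e a ≟ e b
... | yes _   | yes _     = refl
... | yes a≡b | no  ea≢eb = ⊥-elim (ea≢eb (cong e a≡b))
... | no  a≢b | yes ea≡eb = ⊥-elim (a≢b (e-injective ea≡eb))
... | no  _   | no  _     = refl

fixedTerm-along : ∀ {k m} c (e : Fin k → Fin m) → Injective _≡_ _≡_ e →
  (x : SignedInv m) (y : SignedInv k) →
  (∀ i → image x (e i) ≡ e (image y i)) → (∀ i → sign x (e i) ≡ sign y i) →
  fixedTerm c x ∘ e ≗ fixedTerm c y
fixedTerm-along c e e-injective x y same-image same-sign i =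
  cong₂ (λ b σ → indicator (b ∧ c σ)) fixedness (same-sign i)
  where
  fixedness : ⌊ image x (e i) ≟ e i ⌋ ≡ ⌊ image y i ≟ i ⌋
  fixedness =
    trans (cong (λ a → ⌊ a ≟ e i ⌋) (same-image i)) (≟-injective e e-injective (image y i) i)

fixedCount-fix : ∀ {n} c σ (y : SignedInv n) →
  fixedCount c (fix σ y) ≡ indicator (c σ) + fixedCount c y
fixedCount-fix c σ y = cong (indicator (c σ) +_)
  (sum-cong-≗ (fixedTerm-along c suc suc-injective (fix σ y) y (image-fix σ y) (sign-fix σ y)))

fixedCount-pair : ∀ {k} c j (y : SignedInv k) → fixedCount c (pair j y) ≡ fixedCount c y
fixedCount-pair c j y = begin
  ∑ (t ∘ suc)                          ≡⟨ sum-remove {i = j} (t ∘ suc) ⟩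
  t (suc j) + ∑ (t ∘ suc ∘ punchIn j)  ≡⟨ cong₂ _+_ partnerTerm (sum-cong-≗ otherTerms) ⟩
  ∑ (fixedTerm c y)                    ∎
  where
  open ≡-Reasoning
  t = fixedTerm c (pair j y)
  partnerTerm : t (suc j) ≡ 0
  partnerTerm =
    cong (λ a → indicator (⌊ a ≟ suc j ⌋ ∧ c (sign (pair j y) (suc j)))) (image-pair-partner j y)
  otherTerms : t ∘ suc ∘ punchIn j ≗ fixedTerm c y
  otherTerms = fixedTerm-along c (outside j) (outside-injective j)
    (pair j y) y (image-pair-other j y) (sign-pair-other j y)

Balanced : ∀ {n} → ℕ → ℕ → SignedInv n → Set
Balanced p q x = fixedCount isPlus x + q ≡ fixedCount (not ∘ isPlus) x + p

BalancedInv : ℕ → ℕ → ℕ → Set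
BalancedInv n p q = Σ (SignedInv n) (Balanced p q)

-- An equation between natural numbers is a proposition, so equations
-- implying each other are isomorphic.
≡-↔ : ∀ {a b c d : ℕ} → (a ≡ b → c ≡ d) → (c ≡ d → a ≡ b) → (a ≡ b) ↔ (c ≡ d)
≡-↔ to from = mk↔ₛ′ to from (λ _ → ≡-irrelevant _ _) (λ _ → ≡-irrelevant _ _)

rewrite-↔ : ∀ {a b c d : ℕ} → a ≡ c → b ≡ d → (a ≡ b) ↔ (c ≡ d)
rewrite-↔ a≡c b≡d =
  ≡-↔ (λ a≡b → trans (sym a≡c) (trans a≡b b≡d)) (λ c≡d → trans a≡c (trans c≡d (sym b≡d)))

Balanced-fix-plus : ∀ {n} p q (y : SignedInv n) → Balanced p q (fix plus y) ↔ Balanced p (suc q) y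
Balanced-fix-plus p q y = rewrite-↔
  (trans (cong (_+ q) (fixedCount-fix isPlus plus y)) (sym (+-suc _ q)))
  (cong (_+ p) (fixedCount-fix (not ∘ isPlus) plus y))

Balanced-fix-minus : ∀ {n} p q (y : SignedInv n) → Balanced p q (fix minus y) ↔ Balanced (suc p) q y
Balanced-fix-minus p q y = rewrite-↔
  (cong (_+ q) (fixedCount-fix isPlus minus y))
  (trans (cong (_+ p) (fixedCount-fix (not ∘ isPlus) minus y)) (sym (+-suc _ p)))

Balanced-pair : ∀ {n} p q (j : Fin n) (y : SignedInv (pred n)) →
  Balanced p q (pairWith j y) ↔ Balanced p q y
Balanced-pair {suc k} p q j y = rewrite-↔
  (cong (_+ q) (fixedCount-pair isPlus j y)) (cong (_+ p) (fixedCount-pair (not ∘ isPlus) j y))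

Balanced-shift : ∀ {n} p q (x : SignedInv n) → Balanced (suc p) (suc q) x ↔ Balanced p q x
Balanced-shift p q x = ↔-trans (rewrite-↔ (+-suc _ q) (+-suc _ p)) (≡-↔ (cong pred) (cong suc))

-- At most n points are fixed, so the balance fails when p or q exceeds n.
overshoot : ∀ {a b n p} → a ≤ n → n < p → a ≢ b + p
overshoot {b = b} {p = p} a≤n n<p a≡b+p =
  <-irrefl a≡b+p (≤-<-trans a≤n (<-≤-trans n<p (m≤n+m p b)))

unbalancedˡ : ∀ {n p} → n < p → ¬ BalancedInv n p 0
unbalancedˡ n<p (x , balanced) =
  overshoot (≤-trans (≤-reflexive (+-identityʳ _)) (fixedCount≤ isPlus x)) n<p balanced

unbalancedʳ : ∀ {n q} → n < q → ¬ BalancedInv n 0 q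
unbalancedʳ n<q (x , balanced) =
  overshoot (≤-trans (≤-reflexive (+-identityʳ _)) (fixedCount≤ (not ∘ isPlus) x)) n<q (sym balanced)

Σ-Sign : ∀ {A : Set} (P : Sign × A → Set) →
  Σ (Sign × A) P ↔ (Σ A (λ a → P (plus , a)) ⊎ Σ A (λ a → P (minus , a)))
Σ-Sign P = mk↔ₛ′ split join [ (λ _ → refl) , (λ _ → refl) ] join-split
  where
  split : Σ (Sign × _) P → _
  split ((plus  , a) , u) = inj₁ (a , u)
  split ((minus , a) , u) = inj₂ (a , u)
  join : _ → Σ (Sign × _) P
  join = [ (λ (a , u) → (plus , a) , u) , (λ (a , u) → (minus , a) , u) ]′
  join-split : ∀ w → join (split w) ≡ w
  join-split ((plus  , _) , _) = refl
  join-split ((minus , _) , _) = refl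

drop-empty : ∀ {A B : Set} → ¬ B → (A ⊎ B) ↔ A
drop-empty ¬b =
  mk↔ₛ′ [ id , ⊥-elim ∘ ¬b ]′ inj₁ (λ _ → refl) [ (λ _ → refl) , (λ b → ⊥-elim (¬b b)) ]

balancedSplit : ∀ n p q → BalancedInv (suc n) p q ↔
  ((BalancedInv n p (suc q) ⊎ BalancedInv n (suc p) q) ⊎ (Fin n × BalancedInv (pred n) p q))
balancedSplit n p q = begin
  Σ (SignedInv (suc n)) (Balanced p q)
    ↔⟨ Σ-↔ (↔-sym decomposition) ↔-refl ⟨
  Σ (Decomposition n) (Balanced p q ∘ compose)
    ↔⟨ Σ-distribʳ-⊎ ⟩
  (Σ (Sign × SignedInv n) (λ (σ , y) → Balanced p q (fix σ y))
    ⊎ Σ (Fin n × SignedInv (pred n)) (λ (j , y) → Balanced p q (pairWith j y)))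
    ↔⟨ Σ-Sign _ ⊎-cong Σ-assoc ⟩
  ((Σ (SignedInv n) (Balanced p q ∘ fix plus) ⊎ Σ (SignedInv n) (Balanced p q ∘ fix minus))
    ⊎ Σ (Fin n) (λ j → Σ (SignedInv (pred n)) (Balanced p q ∘ pairWith j)))
    ↔⟨ (congˡ (λ {y} → Balanced-fix-plus p q y) ⊎-cong congˡ (λ {y} → Balanced-fix-minus p q y))
         ⊎-cong congˡ (λ {j} → congˡ (λ {y} → Balanced-pair p q j y)) ⟩
  ((BalancedInv n p (suc q) ⊎ BalancedInv n (suc p) q) ⊎ (Fin n × BalancedInv (pred n) p q))
    ∎
  where open EquationalReasoning

shift : ∀ n p q → BalancedInv n (suc p) (suc q) ↔ BalancedInv n p q
shift n p q = congˡ (λ {x} → Balanced-shift p q x)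

count-empty : BalancedInv 0 0 0 ↔ Fin 1
count-empty = mk↔ₛ′ (λ _ → zero) (λ _ → empty) (λ { zero → refl }) unique
  where
  empty : BalancedInv 0 0 0
  empty = signedInv [] [] _ , refl
  unique : ∀ x → empty ≡ x
  unique (signedInv [] [] _ , balanced) = cong (signedInv [] [] _ ,_) (≡-irrelevant refl balanced)

count : ∀ p q → BalancedInv (p + q) p q ↔ Fin (weightedDelannoy p q)
count zero    zero    = count-empty
count (suc p) zero    = begin
  BalancedInv (suc (p + 0)) (suc p) 0
    ↔⟨ balancedSplit (p + 0) (suc p) 0 ⟩
  ((BalancedInv (p + 0) (suc p) 1 ⊎ BalancedInv (p + 0) (suc (suc p)) 0)
    ⊎ (Fin (p + 0) × BalancedInv (pred (p + 0)) (suc p) 0))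
    ↔⟨ drop-empty (λ (_ , x) → unbalancedˡ (s≤s (≤-trans pred[n]≤n p+0≤p)) x) ⟩
  (BalancedInv (p + 0) (suc p) 1 ⊎ BalancedInv (p + 0) (suc (suc p)) 0)
    ↔⟨ drop-empty (unbalancedˡ (m<n⇒m<1+n (s≤s p+0≤p))) ⟩
  BalancedInv (p + 0) (suc p) 1
    ↔⟨ shift (p + 0) p 0 ⟩
  BalancedInv (p + 0) p 0
    ↔⟨ count p zero ⟩
  Fin (weightedDelannoy p zero) ∎
  where
  open EquationalReasoning
  p+0≤p : p + 0 ≤ p
  p+0≤p = ≤-reflexive (+-identityʳ p)
count zero    (suc q) = begin
  BalancedInv (suc q) 0 (suc q)
    ↔⟨ balancedSplit q 0 (suc q) ⟩
  ((BalancedInv q 0 (suc (suc q)) ⊎ BalancedInv q 1 (suc q)) ⊎ (Fin q × BalancedInv (pred q) 0 (suc q)))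
    ↔⟨ drop-empty (λ (_ , x) → unbalancedʳ (s≤s pred[n]≤n) x) ⟩
  (BalancedInv q 0 (suc (suc q)) ⊎ BalancedInv q 1 (suc q))
    ↔⟨ ⊎-comm _ _ ⟩
  (BalancedInv q 1 (suc q) ⊎ BalancedInv q 0 (suc (suc q)))
    ↔⟨ drop-empty (unbalancedʳ (m<n⇒m<1+n (n<1+n q))) ⟩
  BalancedInv q 1 (suc q)
    ↔⟨ shift q 0 q ⟩
  BalancedInv q 0 q
    ↔⟨ count zero q ⟩
  Fin (weightedDelannoy zero q) ∎
  where open EquationalReasoning
count (suc p) (suc q) = begin
  BalancedInv (suc (p + suc q)) (suc p) (suc q)
    ↔⟨ balancedSplit (p + suc q) (suc p) (suc q) ⟩
  ((BalancedInv (p + suc q) (suc p) (suc (suc q)) ⊎ BalancedInv (p + suc q) (suc (suc p)) (suc q))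
    ⊎ (Fin (p + suc q) × BalancedInv (pred (p + suc q)) (suc p) (suc q)))
    ↔⟨ ⊎-assoc _ _ _ _ ⟩
  (BalancedInv (p + suc q) (suc p) (suc (suc q)) ⊎ (BalancedInv (p + suc q) (suc (suc p)) (suc q)
    ⊎ (Fin (p + suc q) × BalancedInv (pred (p + suc q)) (suc p) (suc q))))
    ≡⟨ cong (λ m → BalancedInv (p + suc q) (suc p) (suc (suc q)) ⊎ (BalancedInv m (suc (suc p)) (suc q)
                     ⊎ (Fin m × BalancedInv (pred m) (suc p) (suc q)))) (+-suc p q) ⟩
  (BalancedInv (p + suc q) (suc p) (suc (suc q)) ⊎ (BalancedInv (suc (p + q)) (suc (suc p)) (suc q)
    ⊎ (Fin (suc (p + q)) × BalancedInv (p + q) (suc p) (suc q))))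
    ↔⟨ ↔-trans (shift _ p (suc q)) (count p (suc q))
         ⊎-cong (↔-trans (shift _ (suc p) q) (count (suc p) q)
         ⊎-cong (↔-refl ×-cong ↔-trans (shift _ p q) (count p q))) ⟩
  (Fin (weightedDelannoy p (suc q)) ⊎ (Fin (weightedDelannoy (suc p) q)
    ⊎ (Fin (suc (p + q)) × Fin (weightedDelannoy p q))))
    ↔⟨ ↔-refl ⊎-cong ↔-trans +↔⊎ (↔-refl ⊎-cong *↔×) ⟨
  (Fin (weightedDelannoy p (suc q)) ⊎ Fin (weightedDelannoy (suc p) q + suc (p + q) * weightedDelannoy p q))
    ↔⟨ +↔⊎ ⟨
  Fin (weightedDelannoy (suc p) (suc q)) ∎
  where open EquationalReasoning

∧-split : ∀ a {b c} → T (a ∧ b ∧ c) → T (a ∧ b) × T c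
∧-split true  t = Equivalence.to T-∧ t
∧-split false ()

∧-join : ∀ a {b c} → T (a ∧ b) → T c → T (a ∧ b ∧ c)
∧-join true tb tc = Equivalence.from T-∧ (tb , tc)

SignedInvolution↔BalancedInv : ∀ p q → SignedInvolution p q ↔ BalancedInv (p + q) p q
SignedInvolution↔BalancedInv p q = mk↔ₛ′ to from to∘from from∘to
  where
  balance : ∀ π s v → (numPlusFixed π s + q ≡ numMinusFixed π s + p) ↔ Balanced p q (signedInv π s v)
  balance π s v = rewrite-↔
    (cong (_+ q) (countFin-∑ (p + q) (λ i → isFixed π i ∧ isPlus (lookup s i))))
    (cong (_+ p) (countFin-∑ (p + q) (λ i → isFixed π i ∧ not (isPlus (lookup s i)))))

  to : SignedInvolution p q → BalancedInv (p + q) p q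
  to ((π , s) , t) =
    let valid , balanced = ∧-split (isInvolution π) t
    in signedInv π s valid , Inverse.to (balance π s valid) (≡ᵇ⇒≡ _ _ balanced)

  from : BalancedInv (p + q) p q → SignedInvolution p q
  from (signedInv π s valid , balanced) =
    (π , s) , ∧-join (isInvolution π) valid (≡⇒≡ᵇ _ _ (Inverse.from (balance π s valid) balanced))

  to∘from : ∀ x → to (from x) ≡ x
  to∘from (signedInv π s _ , _) =
    Σ-≡,≡→≡ (cong (signedInv π s) (T-irrelevant _ _) , ≡-irrelevant _ _)

  from∘to : ∀ x → from (to x) ≡ x
  from∘to ((π , s) , _) = Σ-≡,≡→≡ (refl , T-irrelevant _ _)

proposition6p1 : (p q : ℕ) → SignedInvolution p q ↔ Fin (delannoyWeightSum p q)
proposition6p1 p q = begin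
  SignedInvolution p q         ↔⟨ SignedInvolution↔BalancedInv p q ⟩
  BalancedInv (p + q) p q      ↔⟨ count p q ⟩
  Fin (weightedDelannoy p q)   ≡⟨ cong Fin (delannoyWeightSum≡weightedDelannoy p q) ⟨
  Fin (delannoyWeightSum p q)  ∎
  where open EquationalReasoning
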